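{- Let $G$ be a finite simple graph of order $n$ with at least one edge. Then: (i) There exists a mitigating subgraph of $G$ each of whose connected components is isomorphic to $P_2$ or $P_3$ (the path on $2$ or $3$ vertices). (ii) $\mathrm{es}_{\Delta}(G)\le n-\alpha(G)$, where $\alpha(G)$ is the independence number of $G$; moreover, this bound is sharp, i.e. there exist graphs for which equality holds.
   Context: For a graph $G$, $\Delta(G)$ is its maximum degree. A set $S\subseteq E(G)$ is a mitigating set of $G$ if $\Delta(G-S)\le \Delta(G)-1$; the subgraph $G[S]$ induced by the edge set $S$ (the edges of $S$ together with their endpoints) is then called a mitigating subgraph of $G$. The $\Delta$-edge stability number $\mathrm{es}_{\Delta}(G)$ is the minimum number of edges of $G$ whose removal results in a subgraph $H$ with $\Delta(H)=\Delta(G)-1$, i.e. the minimum size of a mitigating set. -}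

module Defs where

open import Data.Nat using (ℕ; zero; suc; _+_; _∸_; _≤_; _<ᵇ_; _⊔_)
open import Data.Fin using (Fin; toℕ)
open import Data.Bool using (Bool; true; false; if_then_else_; _∧_; not)
open import Data.List using (List; map; foldr; allFin; concatMap)
open import Data.Nat.ListAction using (sum)
open import Data.Product using (Σ; ∃; ∃-syntax; _×_; _,_)
open import Data.Sum using (_⊎_)
open import Relation.Nullary using (¬_)
open import Relation.Binary.PropositionalEquality using (_≡_)
open import Relation.Binary.Construct.Closure.ReflexiveTransitive using (Star)

Adj : ℕ → Set
Adj n = Fin n → Fin n → Bool

record Graph (n : ℕ) : Set where
  field
    adj    : Adj n
    sym    : ∀ i j → adj i j ≡ adj j i
    irrefl : ∀ i → adj i i ≡ false
open Graph public

HasEdge : ∀ {n} → Graph n → Set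
HasEdge G = ∃[ i ] ∃[ j ] (adj G i j ≡ true)

countL : ∀ {A : Set} → (A → Bool) → List A → ℕ
countL p xs = sum (map (λ x → if p x then 1 else 0) xs)

degree : ∀ {n} → Adj n → Fin n → ℕ
degree {n} A i = countL (A i) (allFin n)

Δ : ∀ {n} → Adj n → ℕ
Δ {n} A = foldr _⊔_ 0 (map (degree A) (allFin n))

record EdgeSet {n} (G : Graph n) : Set where
  field
    eadj    : Adj n
    esym    : ∀ i j → eadj i j ≡ eadj j i
    eirrefl : ∀ i → eadj i i ≡ false
    sub     : ∀ i j → eadj i j ≡ true → adj G i j ≡ true
open EdgeSet public

-- number of edges in S (unordered pairs {i,j}, counted once via toℕ i < toℕ j)
∣_∣ₑ : ∀ {n} {G : Graph n} → EdgeSet G → ℕ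
∣_∣ₑ {n} S = countL (λ p → (toℕ (Data.Product.proj₁ p) <ᵇ toℕ (Data.Product.proj₂ p))
                          ∧ eadj S (Data.Product.proj₁ p) (Data.Product.proj₂ p))
                    (concatMap (λ i → map (λ j → (i , j)) (allFin n)) (allFin n))

_⊖_ : ∀ {n} (G : Graph n) → EdgeSet G → Adj n
(G ⊖ S) i j = adj G i j ∧ not (eadj S i j)

Mitigating : ∀ {n} (G : Graph n) → EdgeSet G → Set
Mitigating G S = Δ (G ⊖ S) ≤ Δ (adj G) ∸ 1

IsEsΔ : ∀ {n} (G : Graph n) → ℕ → Set
IsEsΔ G e = (Σ (EdgeSet G) λ S → Mitigating G S × ∣ S ∣ₑ ≡ e)
          × (∀ (S : EdgeSet G) → Mitigating G S → e ≤ ∣ S ∣ₑ)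

VSet : ℕ → Set
VSet n = Fin n → Bool

∣_∣ᵥ : ∀ {n} → VSet n → ℕ
∣_∣ᵥ {n} I = countL I (allFin n)

Independent : ∀ {n} → Graph n → VSet n → Set
Independent G I = ∀ i j → I i ≡ true → I j ≡ true → adj G i j ≡ false

IsIndependenceNumber : ∀ {n} (G : Graph n) → ℕ → Set
IsIndependenceNumber G a = (Σ (VSet _) λ I → Independent G I × ∣ I ∣ᵥ ≡ a)
                         × (∀ I → Independent G I → ∣ I ∣ᵥ ≤ a)

-- Mitigating subgraph G[S]: vertices are endpoints of edges of S, edges are S.
-- v is a vertex of G[S]
InSub : ∀ {n} {G : Graph n} → EdgeSet G → Fin n → Set
InSub S v = ∃[ u ] (eadj S v u ≡ true)

Reach : ∀ {n} {G : Graph n} → EdgeSet G → Fin n → Fin n → Set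
Reach S = Star (λ u w → eadj S u w ≡ true)

ComponentP₂ : ∀ {n} {G : Graph n} → EdgeSet G → Fin n → Set
ComponentP₂ S v = ∃[ a ] ∃[ b ] (¬ a ≡ b
  × (∀ w → Reach S v w → (w ≡ a ⊎ w ≡ b))
  × (∀ w → (w ≡ a ⊎ w ≡ b) → Reach S v w)
  × eadj S a b ≡ true)

ComponentP₃ : ∀ {n} {G : Graph n} → EdgeSet G → Fin n → Set
ComponentP₃ S v = ∃[ a ] ∃[ b ] ∃[ c ] (¬ a ≡ b × ¬ b ≡ c × ¬ a ≡ c
  × (∀ w → Reach S v w → (w ≡ a ⊎ w ≡ b ⊎ w ≡ c))
  × (∀ w → (w ≡ a ⊎ w ≡ b ⊎ w ≡ c) → Reach S v w)
  × eadj S a b ≡ true × eadj S b c ≡ true × eadj S a c ≡ false)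

ComponentsP₂P₃ : ∀ {n} {G : Graph n} → EdgeSet G → Set
ComponentsP₂P₃ S = ∀ v → InSub S v → ComponentP₂ S v ⊎ ComponentP₃ S v

-- (i) Take a maximal matching p.  The vertices of maximum degree Δ missed by p have all their
-- neighbours matched, and since they have degree Δ while no vertex has larger degree, a Hall-type
-- counting argument assigns them pairwise distinct neighbours f.  The edges r f(r) together with
-- the matching edges not joining two f-targets then touch every vertex of degree Δ, and each
-- component is an edge x y of p, an edge r x, or a path r x y with p x = y.
-- (ii) For an independent set I the same argument gives distinct neighbours, all outside I, to the
-- vertices of I of degree Δ.  Every vertex c outside I picks its f-preimage if it has one and any
-- neighbour otherwise; the picked edges form a mitigating set with at most n − |I| edges.
-- For K₂ both sides equal 1.

module Submission where

open import Data.Bool using (Bool; true; false; if_then_else_; _∧_; _∨_; not; T)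
import Data.Bool.Properties as Bool
open import Data.Bool.Properties using (∧-conicalˡ; ∧-conicalʳ; ∧-comm; ∧-zeroʳ; ∨-zeroʳ; ¬-not; ⇔→≡)
open import Data.Empty using (⊥; ⊥-elim)
open import Data.Fin using (Fin; toℕ; _≟_) renaming (zero to fzero; suc to fsuc)
open import Data.Fin.Properties using (any?) renaming (suc-injective to fsuc-injective)
open import Data.List using (List; []; _∷_; _++_; map; foldr; allFin; tabulate; concatMap)
open import Data.List.Membership.Propositional using (_∈_)
open import Data.List.Membership.Propositional.Properties using (∈-map⁺; ∈-allFin)
open import Data.List.Properties using (map-tabulate; map-++; map-∘)
open import Data.List.Relation.Unary.All using (All; []; _∷_)
open import Data.List.Relation.Unary.All.Properties using (map⁺; tabulate⁺)
open import Data.List.Relation.Unary.Any using (here; there)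
open import Data.Maybe using (Maybe; just; nothing; is-just; _<∣>_)
import Data.Maybe.Properties as Maybe
open import Data.Nat using (ℕ; zero; suc; _+_; _*_; _∸_; _≤_; _<_; _⊔_; z≤n; s≤s)
import Data.Nat as ℕ
open import Data.Nat.Induction using (<-wellFounded)
open import Data.Nat.ListAction using (sum)
open import Data.Nat.ListAction.Properties using (sum-++)
open import Data.Nat.Properties hiding (_≟_)
open import Data.Product using (Σ; ∃-syntax; _×_; _,_; proj₁; proj₂)
open import Data.Sum using (_⊎_; inj₁; inj₂; swap)
open import Data.Vec.Functional using (updateAt)
open import Data.Vec.Functional.Properties using (updateAt-updates; updateAt-minimal)
open import Function using (_∘_; id; const)
open import Function.Bundles using (mk⇔)
open import Induction.WellFounded using (Acc; acc)
open import Relation.Binary.Construct.Closure.ReflexiveTransitive using (ε; _◅_; _◅◅_)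
open import Relation.Binary.PropositionalEquality
open import Relation.Nullary using (¬_; Dec; yes; no)
open import Relation.Nullary.Decidable using (does; dec-true; ¬?; _×-dec_; decidable-stable)

open import Defs hiding (sym)

open import Algebra.Properties.Semiring.Sum +-*-semiring
  using (∑-distrib-+; ∑-comm; *-distribˡ-sum)
  renaming (sum to ∑; sum-cong-≗ to ∑-cong; sum-replicate-zero to ∑-zero)

true≢false : ¬ true ≡ false
true≢false ()

not-true : ∀ {b} → not b ≡ true → b ≡ false
not-true {false} _ = refl

does⇒ : ∀ {A : Set} (a? : Dec A) → does a? ≡ true → A
does⇒ (yes a) _ = a

nothing≢just : ∀ {A : Set} {x : A} → ¬ nothing ≡ just x
nothing≢just ()

just-or-nothing : ∀ {A : Set} (m : Maybe A) → (∃[ y ] m ≡ just y) ⊎ m ≡ nothing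
just-or-nothing (just y) = inj₁ (y , refl)
just-or-nothing nothing  = inj₂ refl

choice : ∀ {n} {Q : Fin n → Set} → Dec (∃[ i ] Q i) → Maybe (Fin n)
choice (yes (i , _)) = just i
choice (no _)        = nothing

choice-sound : ∀ {n} {Q : Fin n → Set} (q? : Dec (∃[ i ] Q i)) {i} → choice q? ≡ just i → Q i
choice-sound (yes (i , qi)) refl = qi

choice-complete : ∀ {n} {Q : Fin n → Set} (q? : Dec (∃[ i ] Q i)) {i} → Q i → ∃[ j ] choice q? ≡ just j
choice-complete (yes (j , _)) qi = j , refl
choice-complete (no none) {i} qi = ⊥-elim (none (i , qi))

𝟙 : Bool → ℕ
𝟙 b = if b then 1 else 0

𝟙-positive : ∀ {b} → 0 < 𝟙 b → b ≡ true
𝟙-positive {true} _ = refl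

𝟙-mono : ∀ {a b} → (a ≡ true → b ≡ true) → 𝟙 a ≤ 𝟙 b
𝟙-mono {false} a⇒b = z≤n
𝟙-mono {true}  a⇒b = ≤-reflexive (cong 𝟙 (sym (a⇒b refl)))

𝟙-∨ : ∀ a b c → (a ≡ true → b ≡ true ⊎ c ≡ true) → 𝟙 a ≤ 𝟙 b + 𝟙 c
𝟙-∨ false b c _ = z≤n
𝟙-∨ true  b c split with split refl
... | inj₁ refl = s≤s z≤n
... | inj₂ refl = m≤n+m 1 (𝟙 b)

𝟙-disjoint : ∀ a b e → (a ≡ true → b ≡ true → ⊥) → 𝟙 (a ∧ e) + 𝟙 (b ∧ e) ≤ 𝟙 e
𝟙-disjoint true  true  e apart = ⊥-elim (apart refl refl)
𝟙-disjoint true  false e apart = ≤-reflexive (+-identityʳ (𝟙 e))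
𝟙-disjoint false b     e apart = 𝟙-mono (∧-conicalʳ b e)

count : ∀ {n} → (Fin n → Bool) → ℕ
count p = ∑ (𝟙 ∘ p)

∑-mono-≤ : ∀ {n} {f g : Fin n → ℕ} → (∀ i → f i ≤ g i) → ∑ f ≤ ∑ g
∑-mono-≤ {zero}  f≤g = z≤n
∑-mono-≤ {suc n} f≤g = +-mono-≤ (f≤g fzero) (∑-mono-≤ (f≤g ∘ fsuc))

∑-mono-< : ∀ {n} {f g : Fin n → ℕ} → (∀ i → f i ≤ g i) → ∀ k → f k < g k → ∑ f < ∑ g
∑-mono-< f≤g fzero    fk<gk = +-mono-<-≤ fk<gk (∑-mono-≤ (f≤g ∘ fsuc))
∑-mono-< f≤g (fsuc k) fk<gk = +-mono-≤-< (f≤g fzero) (∑-mono-< (f≤g ∘ fsuc) k fk<gk)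

∑-≥-term : ∀ {n} (f : Fin n → ℕ) k → f k ≤ ∑ f
∑-≥-term f fzero    = m≤m+n _ _
∑-≥-term f (fsuc k) = ≤-trans (∑-≥-term (f ∘ fsuc) k) (m≤n+m _ _)

∑-single : ∀ {n} (f : Fin n → ℕ) k → (∀ j → ¬ j ≡ k → f j ≡ 0) → ∑ f ≡ f k
∑-single {suc n} f fzero others =
  trans (cong (f fzero +_) (trans (∑-cong (λ j → others (fsuc j) λ ())) (∑-zero n))) (+-identityʳ _)
∑-single f (fsuc k) others =
  cong₂ _+_ (others fzero λ ()) (∑-single (f ∘ fsuc) k (λ j j≢k → others (fsuc j) (j≢k ∘ fsuc-injective)))

∑-positive : ∀ {n} (f : Fin n → ℕ) → 0 < ∑ f → ∃[ i ] 0 < f i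
∑-positive {suc n} f 0<∑ with f fzero in eq
... | suc _ = fzero , subst (0 <_) (sym eq) (s≤s z≤n)
... | zero  = let i , 0<fi = ∑-positive (f ∘ fsuc) 0<∑ in fsuc i , 0<fi

_⊆ᵇ_ : ∀ {n} → (Fin n → Bool) → (Fin n → Bool) → Set
q ⊆ᵇ p = ∀ i → q i ≡ true → p i ≡ true

not-⊆ᵇ : ∀ {n} {q p : Fin n → Bool} → q ⊆ᵇ p → (not ∘ p) ⊆ᵇ (not ∘ q)
not-⊆ᵇ {q = q} {p} q⊆p i ¬pi with q i in qi
... | false = refl
... | true  = trans (cong not (sym (q⊆p i qi))) ¬pi

count-mono : ∀ {n} {q p : Fin n → Bool} → q ⊆ᵇ p → count q ≤ count p
count-mono q⊆p = ∑-mono-≤ (λ i → 𝟙-mono (q⊆p i))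

count-< : ∀ {n} {q p : Fin n → Bool} → q ⊆ᵇ p → ∀ k → q k ≡ false → p k ≡ true → count q < count p
count-< q⊆p k qk pk = ∑-mono-< (λ i → 𝟙-mono (q⊆p i)) k (subst₂ (λ a b → 𝟙 a < 𝟙 b) (sym qk) (sym pk) ≤-refl)

count-not : ∀ {n} (p : Fin n → Bool) → count (not ∘ p) ≡ n ∸ count p
count-not {n} p = begin
  count (not ∘ p)                      ≡⟨ m+n∸n≡m (count (not ∘ p)) (count p) ⟨
  count (not ∘ p) + count p ∸ count p  ≡⟨ cong (_∸ count p) (∑-distrib-+ (𝟙 ∘ not ∘ p) (𝟙 ∘ p)) ⟨
  ∑ (λ i → 𝟙 (not (p i)) + 𝟙 (p i)) ∸ count p  ≡⟨ cong (_∸ count p) (trans (∑-cong one) (∑-one n)) ⟩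
  n ∸ count p                          ∎
  where
  open ≡-Reasoning
  one : ∀ i → 𝟙 (not (p i)) + 𝟙 (p i) ≡ 1
  one i with p i
  ... | true  = refl
  ... | false = refl
  ∑-one : ∀ n → ∑ {n} (λ _ → 1) ≡ n
  ∑-one zero    = refl
  ∑-one (suc n) = cong suc (∑-one n)

sum-map-allFin : ∀ {n} (f : Fin n → ℕ) → sum (map f (allFin n)) ≡ ∑ f
sum-map-allFin {n} f = trans (cong sum (map-tabulate id f)) (sum-tabulate f)
  where
  sum-tabulate : ∀ {n} (f : Fin n → ℕ) → sum (tabulate f) ≡ ∑ f
  sum-tabulate {zero}  f = refl
  sum-tabulate {suc n} f = cong (f fzero +_) (sum-tabulate (f ∘ fsuc))

countL-allFin : ∀ {n} (p : Fin n → Bool) → countL p (allFin n) ≡ count p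
countL-allFin p = sum-map-allFin (𝟙 ∘ p)

countL-pairs : ∀ {n} (q : Fin n × Fin n → Bool) →
  countL q (concatMap (λ i → map (i ,_) (allFin n)) (allFin n)) ≡ ∑ (λ i → ∑ (λ j → 𝟙 (q (i , j))))
countL-pairs {n} q = begin
  countL q (concatMap row (allFin n))         ≡⟨ countL-concatMap (allFin n) ⟩
  sum (map (countL q ∘ row) (allFin n))       ≡⟨ sum-map-allFin (countL q ∘ row) ⟩
  ∑ (countL q ∘ row)                          ≡⟨ ∑-cong count-row ⟩
  ∑ (λ i → ∑ (λ j → 𝟙 (q (i , j))))           ∎
  where
  open ≡-Reasoning
  row : Fin n → List (Fin n × Fin n)
  row i = map (i ,_) (allFin n)
  countL-concatMap : ∀ xs → countL q (concatMap row xs) ≡ sum (map (countL q ∘ row) xs)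
  countL-concatMap []       = refl
  countL-concatMap (x ∷ xs) = trans (countL-++ (row x) _) (cong (countL q (row x) +_) (countL-concatMap xs))
    where
    countL-++ : ∀ ys zs → countL q (ys ++ zs) ≡ countL q ys + countL q zs
    countL-++ ys zs = trans (cong sum (map-++ _ ys zs)) (sum-++ (map _ ys) _)
  count-row : ∀ i → countL q (row i) ≡ ∑ (λ j → 𝟙 (q (i , j)))
  count-row i = trans (cong sum (sym (map-∘ (allFin n)))) (sum-map-allFin (λ j → 𝟙 (q (i , j))))

PartialMap : ℕ → Set
PartialMap n = Fin n → Maybe (Fin n)

_[_]≔_ : ∀ {n} {A : Set} → (Fin n → A) → Fin n → A → Fin n → A
f [ i ]≔ v = updateAt f i (const v)

module _ {n} {A : Set} (f : Fin n → A) (i : Fin n) (v : A) where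

  ≔-here : (f [ i ]≔ v) i ≡ v
  ≔-here = updateAt-updates i f

  ≔-there : ∀ {x} → ¬ x ≡ i → (f [ i ]≔ v) x ≡ f x
  ≔-there {x} x≢i = updateAt-minimal x i f x≢i

  ≔-cases : ∀ x → (x ≡ i × (f [ i ]≔ v) x ≡ v) ⊎ (¬ x ≡ i × (f [ i ]≔ v) x ≡ f x)
  ≔-cases x with x ≟ i
  ... | yes refl = inj₁ (refl , ≔-here)
  ... | no x≢i   = inj₂ (x≢i , ≔-there x≢i)

≔-just : ∀ {n} {B : Set} (f : Fin n → Maybe B) i v {x r} → (f [ i ]≔ v) x ≡ just r →
         (x ≡ i × v ≡ just r) ⊎ (¬ x ≡ i × f x ≡ just r)
≔-just f i v {x} e with ≔-cases f i v x
... | inj₁ (refl , fx≡v) = inj₁ (refl , trans (sym fx≡v) e)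
... | inj₂ (x≢i , fx≡)   = inj₂ (x≢i , trans (sym fx≡) e)

≔-mono : ∀ {n} {A : Set} (h : A → Bool) (f : Fin n → A) i {v} → h v ≡ true → (h ∘ f) ⊆ᵇ (h ∘ (f [ i ]≔ v))
≔-mono h f i {v} hv x hfx with ≔-cases f i v x
... | inj₁ (_ , e) = trans (cong h e) hv
... | inj₂ (_ , e) = trans (cong h e) hfx

≔-≔-first : ∀ {n} {A : Set} (f : Fin n → A) {x y a b} → ¬ x ≡ y → ((f [ x ]≔ a) [ y ]≔ b) x ≡ a
≔-≔-first f {x} {y} {a} {b} x≢y = trans (≔-there _ y b x≢y) (≔-here f x a)

_⊑_ : ∀ {n} → PartialMap n → PartialMap n → Set
f ⊑ g = (is-just ∘ f) ⊆ᵇ (is-just ∘ g)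

_↦?_ : ∀ {n} → Maybe (Fin n) → Fin n → Bool
m ↦? r = does (Maybe.≡-dec _≟_ m (just r))

↦?-complete : ∀ {n} {m : Maybe (Fin n)} {r} → m ≡ just r → (m ↦? r) ≡ true
↦?-complete {m = m} {r} = dec-true (Maybe.≡-dec _≟_ m (just r))

↦?-sound : ∀ {n} (m : Maybe (Fin n)) {r} → (m ↦? r) ≡ true → m ≡ just r
↦?-sound m {r} = does⇒ (Maybe.≡-dec _≟_ m (just r))

count-↦? : ∀ {n} (m : Maybe (Fin n)) → count (m ↦?_) ≡ 𝟙 (is-just m)
count-↦? {n} nothing  = ∑-zero n
count-↦? (just x) = trans (∑-single _ x others) (cong 𝟙 (↦?-complete {m = just x} refl))
  where
  others : ∀ j → ¬ j ≡ x → 𝟙 (just x ↦? j) ≡ 0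
  others j j≢x with x ≟ j
  ... | yes x≡j = ⊥-elim (j≢x (sym x≡j))
  ... | no _    = refl

descend : ∀ {A B : Set} (μ : A → ℕ) → (∀ a → B ⊎ Σ A (λ a′ → μ a′ < μ a)) → A → B
descend {A} {B} μ step a = go a (<-wellFounded (μ a))
  where
  go : ∀ a → Acc _<_ (μ a) → B
  go a (acc smaller) with step a
  ... | inj₁ b         = b
  ... | inj₂ (a′ , lt) = go a′ (smaller lt)

foldr-⊔-upper : ∀ {x xs} → x ∈ xs → x ≤ foldr _⊔_ 0 xs
foldr-⊔-upper (here refl) = m≤m⊔n _ _
foldr-⊔-upper (there x∈xs) = ≤-trans (foldr-⊔-upper x∈xs) (m≤n⊔m _ _)

foldr-⊔-lub : ∀ {k xs} → All (_≤ k) xs → foldr _⊔_ 0 xs ≤ k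
foldr-⊔-lub []       = z≤n
foldr-⊔-lub (p ∷ ps) = ⊔-lub p (foldr-⊔-lub ps)

degree≡count : ∀ {n} (A : Adj n) i → degree A i ≡ count (A i)
degree≡count A i = countL-allFin (A i)

degree≤Δ : ∀ {n} (A : Adj n) i → degree A i ≤ Δ A
degree≤Δ A i = foldr-⊔-upper (∈-map⁺ (degree A) (∈-allFin i))

Δ-lub : ∀ {n} (A : Adj n) {k} → (∀ i → degree A i ≤ k) → Δ A ≤ k
Δ-lub A bound = foldr-⊔-lub (map⁺ (tabulate⁺ bound))

Δ-positive : ∀ {n} (G : Graph n) → HasEdge G → 0 < Δ (adj G)
Δ-positive G (i , j , i~j) = begin-strict
  0                      <⟨ subst (0 <_) (cong 𝟙 (sym i~j)) ≤-refl ⟩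
  𝟙 (adj G i j)          ≤⟨ ∑-≥-term (𝟙 ∘ adj G i) j ⟩
  count (adj G i)        ≡⟨ degree≡count (adj G) i ⟨
  degree (adj G) i       ≤⟨ degree≤Δ (adj G) i ⟩
  Δ (adj G)              ∎
  where open ≤-Reasoning

positive-degree⇒neighbour : ∀ {n} (A : Adj n) {v} → 0 < degree A v → ∃[ u ] A v u ≡ true
positive-degree⇒neighbour A {v} 0<deg =
  let u , 0<𝟙 = ∑-positive (𝟙 ∘ A v) (subst (0 <_) (degree≡count A v) 0<deg) in u , 𝟙-positive 0<𝟙

adj⇒≢ : ∀ {n} (G : Graph n) {x y} → adj G x y ≡ true → ¬ x ≡ y
adj⇒≢ G {x} x~y refl = true≢false (trans (sym x~y) (irrefl G x))

is-max-degree : ∀ {n} → Graph n → Fin n → Bool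
is-max-degree G v = does (degree (adj G) v ℕ.≟ Δ (adj G))

is-max-degree-sound : ∀ {n} (G : Graph n) {v} → is-max-degree G v ≡ true → degree (adj G) v ≡ Δ (adj G)
is-max-degree-sound G = does⇒ (_ ℕ.≟ _)

<⇒≤∸1 : ∀ {m n} → m < n → m ≤ n ∸ 1
<⇒≤∸1 {n = suc n} (s≤s m≤n) = m≤n

covering⇒mitigating : ∀ {n} (G : Graph n) (S : EdgeSet G) →
  (∀ v → degree (adj G) v ≡ Δ (adj G) → ∃[ u ] eadj S v u ≡ true) → Mitigating G S
covering⇒mitigating G S covers = Δ-lub (G ⊖ S) bound
  where
  removed≤ : ∀ v u → 𝟙 ((G ⊖ S) v u) ≤ 𝟙 (adj G v u)
  removed≤ v u = 𝟙-mono (∧-conicalˡ (adj G v u) _)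
  bound : ∀ v → degree (G ⊖ S) v ≤ Δ (adj G) ∸ 1
  bound v with degree (adj G) v ℕ.≟ Δ (adj G)
  ... | yes deg≡Δ with covers v deg≡Δ
  ...   | u , v~u = <⇒≤∸1 (begin-strict
    degree (G ⊖ S) v   ≡⟨ degree≡count (G ⊖ S) v ⟩
    count ((G ⊖ S) v)  <⟨ ∑-mono-< (removed≤ v) u removed ⟩
    count (adj G v)    ≡⟨ degree≡count (adj G) v ⟨
    degree (adj G) v   ≡⟨ deg≡Δ ⟩
    Δ (adj G)          ∎)
    where
    open ≤-Reasoning
    removed : 𝟙 ((G ⊖ S) v u) < 𝟙 (adj G v u)
    removed = subst₂ (λ a b → 𝟙 (a ∧ not b) < 𝟙 a) (sym (sub S v u v~u)) (sym v~u) ≤-refl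
  bound v | no deg≢Δ = <⇒≤∸1 (begin-strict
    degree (G ⊖ S) v   ≡⟨ degree≡count (G ⊖ S) v ⟩
    count ((G ⊖ S) v)  ≤⟨ ∑-mono-≤ (removed≤ v) ⟩
    count (adj G v)    ≡⟨ degree≡count (adj G) v ⟨
    degree (adj G) v   <⟨ ≤∧≢⇒< (degree≤Δ (adj G) v) deg≢Δ ⟩
    Δ (adj G)          ∎)
    where open ≤-Reasoning

edge-set : ∀ {n} (G : Graph n) (e : Adj n) → (∀ {x y} → e x y ≡ true → e y x ≡ true) →
           (∀ {x y} → e x y ≡ true → adj G x y ≡ true) → EdgeSet G
edge-set G e e-sym e⊆G = record
  { eadj = e ; esym = λ x y → ⇔→≡ (mk⇔ e-sym e-sym) ; eirrefl = irreflexive ; sub = λ _ _ → e⊆G }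
  where
  irreflexive : ∀ x → e x x ≡ false
  irreflexive x = ¬-not λ exx → true≢false (trans (sym (e⊆G exx)) (irrefl G x))

module _ {n} {G : Graph n} (S : EdgeSet G) where

  eadj⇒≢ : ∀ {a b} → eadj S a b ≡ true → ¬ a ≡ b
  eadj⇒≢ {a} a~b refl = true≢false (trans (sym a~b) (eirrefl S a))

  Reach-closed : (K : Fin n → Set) → (∀ {w z} → K w → eadj S w z ≡ true → K z) →
                 ∀ {v w} → K v → Reach S v w → K w
  Reach-closed K closed Kv ε        = Kv
  Reach-closed K closed Kv (e ◅ es) = Reach-closed K closed (closed Kv e) es

  component-P₂ : ∀ {a b} → eadj S a b ≡ true →
                 (∀ {w z} → w ≡ a ⊎ w ≡ b → eadj S w z ≡ true → z ≡ a ⊎ z ≡ b) →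
                 ∀ {v} → v ≡ a ⊎ v ≡ b → ComponentP₂ S v
  component-P₂ {a} {b} a~b closed {v} v∈ =
    a , b , eadj⇒≢ a~b , (λ w → Reach-closed _ closed v∈) , reach v∈ , a~b
    where
    reach : ∀ {v} → v ≡ a ⊎ v ≡ b → ∀ w → w ≡ a ⊎ w ≡ b → Reach S v w
    reach (inj₁ refl) _ (inj₁ refl) = ε
    reach (inj₁ refl) _ (inj₂ refl) = a~b ◅ ε
    reach (inj₂ refl) _ (inj₁ refl) = trans (esym S b a) a~b ◅ ε
    reach (inj₂ refl) _ (inj₂ refl) = ε

  component-P₃ : ∀ {a b c} → eadj S a b ≡ true → eadj S b c ≡ true → eadj S a c ≡ false → ¬ a ≡ c →
                 (∀ {w z} → w ≡ a ⊎ w ≡ b ⊎ w ≡ c → eadj S w z ≡ true → z ≡ a ⊎ z ≡ b ⊎ z ≡ c) →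
                 ∀ {v} → v ≡ a ⊎ v ≡ b ⊎ v ≡ c → ComponentP₃ S v
  component-P₃ {a} {b} {c} a~b b~c a≁c a≢c closed {v} v∈ =
    a , b , c , eadj⇒≢ a~b , eadj⇒≢ b~c , a≢c , (λ w → Reach-closed _ closed v∈) , reach v∈ , a~b , b~c , a≁c
    where
    to-b : ∀ {v} → v ≡ a ⊎ v ≡ b ⊎ v ≡ c → Reach S v b
    to-b (inj₁ refl)        = a~b ◅ ε
    to-b (inj₂ (inj₁ refl)) = ε
    to-b (inj₂ (inj₂ refl)) = trans (esym S c b) b~c ◅ ε
    reach : ∀ {v} → v ≡ a ⊎ v ≡ b ⊎ v ≡ c → ∀ w → w ≡ a ⊎ w ≡ b ⊎ w ≡ c → Reach S v w
    reach v∈ _ (inj₁ refl)        = to-b v∈ ◅◅ (trans (esym S b a) a~b ◅ ε)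
    reach v∈ _ (inj₂ (inj₁ refl)) = to-b v∈
    reach v∈ _ (inj₂ (inj₂ refl)) = to-b v∈ ◅◅ (b~c ◅ ε)

module _ {n} {G : Graph n} (S : EdgeSet G) (h : PartialMap n) where

  size≤defined : (∀ {x y} → eadj S x y ≡ true → h x ≡ just y ⊎ h y ≡ just x) → ∣ S ∣ₑ ≤ count (is-just ∘ h)
  size≤defined along-h = begin
    ∣ S ∣ₑ                                            ≡⟨ countL-pairs (λ (i , j) → i ≺ j ∧ eadj S i j) ⟩
    ∑ (λ i → ∑ (λ j → 𝟙 (i ≺ j ∧ eadj S i j)))        ≤⟨ ∑-mono-≤ (λ i → ∑-mono-≤ (λ j → 𝟙-∨ _ _ _ (split i j))) ⟩
    ∑ (λ i → ∑ (λ j → out i j + in′ j i))             ≡⟨ ∑-cong (λ i → ∑-distrib-+ (out i) (λ j → in′ j i)) ⟩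
    ∑ (λ i → ∑ (out i) + ∑ (λ j → in′ j i))           ≡⟨ ∑-distrib-+ (λ i → ∑ (out i)) (λ i → ∑ (λ j → in′ j i)) ⟩
    ∑ (λ i → ∑ (out i)) + ∑ (λ i → ∑ (λ j → in′ j i)) ≡⟨ cong (∑ (λ i → ∑ (out i)) +_) (∑-comm (λ i j → in′ j i)) ⟩
    ∑ (λ i → ∑ (out i)) + ∑ (λ j → ∑ (in′ j))         ≡⟨ ∑-distrib-+ (λ i → ∑ (out i)) (λ i → ∑ (in′ i)) ⟨
    ∑ (λ i → ∑ (out i) + ∑ (in′ i))                   ≡⟨ ∑-cong (λ i → ∑-distrib-+ (out i) (in′ i)) ⟨
    ∑ (λ i → ∑ (λ j → out i j + in′ i j))             ≤⟨ ∑-mono-≤ (λ i → ∑-mono-≤ (λ j → 𝟙-disjoint _ _ _ (≺-asym i j))) ⟩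
    ∑ (λ i → ∑ (λ j → 𝟙 (E i j)))                     ≡⟨ ∑-cong (λ i → count-↦? (h i)) ⟩
    count (is-just ∘ h)                               ∎
    where
    open ≤-Reasoning
    _≺_ : Fin n → Fin n → Bool
    i ≺ j = toℕ i ℕ.<ᵇ toℕ j
    E : Fin n → Fin n → Bool
    E a b = h a ↦? b
    out in′ : Fin n → Fin n → ℕ
    out i j = 𝟙 (i ≺ j ∧ E i j)
    in′ i j = 𝟙 (j ≺ i ∧ E i j)
    ≺⇒< : ∀ a b → a ≺ b ≡ true → toℕ a < toℕ b
    ≺⇒< a b a≺b = <ᵇ⇒< (toℕ a) (toℕ b) (subst T (sym a≺b) _)
    ≺-asym : ∀ a b → a ≺ b ≡ true → b ≺ a ≡ true → ⊥
    ≺-asym a b a≺b b≺a = <-asym (≺⇒< a b a≺b) (≺⇒< b a b≺a)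
    split : ∀ i j → i ≺ j ∧ eadj S i j ≡ true → i ≺ j ∧ E i j ≡ true ⊎ i ≺ j ∧ E j i ≡ true
    split i j e with along-h (∧-conicalʳ (i ≺ j) _ e)
    ... | inj₁ hij = inj₁ (cong₂ _∧_ (∧-conicalˡ _ _ e) (↦?-complete hij))
    ... | inj₂ hji = inj₂ (cong₂ _∧_ (∧-conicalˡ _ _ e) (↦?-complete hji))

-- Maximal matchings

module _ {n} (G : Graph n) where

  record Matching (p : PartialMap n) : Set where
    field
      adjacent  : ∀ {x y} → p x ≡ just y → adj G x y ≡ true
      symmetric : ∀ {x y} → p x ≡ just y → p y ≡ just x

  Maximal : PartialMap n → Set
  Maximal p = ∀ {x y} → p x ≡ nothing → adj G x y ≡ true → ∃[ z ] p y ≡ just z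

  matching-add : ∀ {p x y} → Matching p → adj G x y ≡ true → p x ≡ nothing → p y ≡ nothing →
                 Matching ((p [ x ]≔ just y) [ y ]≔ just x)
  matching-add {p} {x} {y} M x~y px py = record { adjacent = adjacent′ ; symmetric = symmetric′ }
    where
    open Matching M
    q : PartialMap n
    q = (p [ x ]≔ just y) [ y ]≔ just x
    q-cases : ∀ {z w} → q z ≡ just w → (z ≡ y × w ≡ x) ⊎ (z ≡ x × w ≡ y) ⊎ p z ≡ just w
    q-cases e with ≔-just (p [ x ]≔ just y) y (just x) e
    ... | inj₁ (refl , refl) = inj₁ (refl , refl)
    ... | inj₂ (_ , e′) with ≔-just p x (just y) e′
    ... | inj₁ (refl , refl) = inj₂ (inj₁ (refl , refl))
    ... | inj₂ (_ , e″)      = inj₂ (inj₂ e″)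
    qx : q x ≡ just y
    qx = ≔-≔-first p (adj⇒≢ G x~y)
    adjacent′ : ∀ {z w} → q z ≡ just w → adj G z w ≡ true
    adjacent′ e with q-cases e
    ... | inj₁ (refl , refl)        = trans (Graph.sym G y x) x~y
    ... | inj₂ (inj₁ (refl , refl)) = x~y
    ... | inj₂ (inj₂ pz)            = adjacent pz
    unmatched≢ : ∀ {z w u} → p z ≡ just w → p u ≡ nothing → ¬ w ≡ u
    unmatched≢ pz pu refl = nothing≢just (trans (sym pu) (symmetric pz))
    symmetric′ : ∀ {z w} → q z ≡ just w → q w ≡ just z
    symmetric′ e with q-cases e
    ... | inj₁ (refl , refl)        = qx
    ... | inj₂ (inj₁ (refl , refl)) = ≔-here _ y (just x)
    ... | inj₂ (inj₂ pz)            =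
      trans (≔-there _ y (just x) (unmatched≢ pz py))
            (trans (≔-there p x (just y) (unmatched≢ pz px)) (symmetric pz))

  maximal-matching : ∃[ p ] Matching p × Maximal p
  maximal-matching = descend unmatched grow (const nothing , record { adjacent = λ () ; symmetric = λ () })
    where
    unmatched : Σ (PartialMap n) Matching → ℕ
    unmatched (p , _) = count (not ∘ is-just ∘ p)
    grow : ∀ pM → (∃[ p ] Matching p × Maximal p) ⊎
                  Σ (Σ (PartialMap n) Matching) (λ qM → unmatched qM < unmatched pM)
    grow (p , M) with any? (λ x → any? (λ y →
      (adj G x y Bool.≟ true) ×-dec (Maybe.≡-dec _≟_ (p x) nothing) ×-dec (Maybe.≡-dec _≟_ (p y) nothing)))
    ... | yes (x , y , x~y , px , py) =
      inj₂ ((q , matching-add M x~y px py) , count-< q⊆p x (cong (not ∘ is-just) qx) (cong (not ∘ is-just) px))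
      where
      q : PartialMap n
      q = (p [ x ]≔ just y) [ y ]≔ just x
      qx : q x ≡ just y
      qx = ≔-≔-first p (adj⇒≢ G x~y)
      q⊆p : (not ∘ is-just ∘ q) ⊆ᵇ (not ∘ is-just ∘ p)
      q⊆p = not-⊆ᵇ (λ i e → ≔-mono is-just (p [ x ]≔ just y) y refl i (≔-mono is-just p x refl i e))
    ... | no none = inj₁ (p , M , maximal)
      where
      maximal : Maximal p
      maximal {x} {y} px x~y with p y in py
      ... | just z  = z , refl
      ... | nothing = ⊥-elim (none (x , y , x~y , px , py))

-- Distinct neighbours for vertices of maximum degree

module _ {n} (G : Graph n) (P : Fin n → Bool) where

  record DistinctNeighbours (f : PartialMap n) : Set where
    field
      adjacent  : ∀ {l r} → f l ≡ just r → adj G l r ≡ true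
      domain    : ∀ {l r} → f l ≡ just r → P l ≡ true
      injective : ∀ {l l′ r} → f l ≡ just r → f l′ ≡ just r → l ≡ l′

  unassign : ∀ {f} → DistinctNeighbours f → ∀ l → DistinctNeighbours (f [ l ]≔ nothing)
  unassign {f} F l = record
    { adjacent  = adjacent ∘ old
    ; domain    = domain ∘ old
    ; injective = λ e e′ → injective (old e) (old e′)
    }
    where
    open DistinctNeighbours F
    old : ∀ {x r} → (f [ l ]≔ nothing) x ≡ just r → f x ≡ just r
    old e with ≔-just f l nothing e
    ... | inj₂ (_ , e′) = e′

  assign : ∀ {f l r} → DistinctNeighbours f → P l ≡ true → adj G l r ≡ true → (∀ x → ¬ f x ≡ just r) →
           DistinctNeighbours (f [ l ]≔ just r)
  assign {f} {l} {r} F Pl l~r free = record { adjacent = adjacent′ ; domain = domain′ ; injective = injective′ }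
    where
    open DistinctNeighbours F
    adjacent′ : ∀ {x s} → (f [ l ]≔ just r) x ≡ just s → adj G x s ≡ true
    adjacent′ e with ≔-just f l (just r) e
    ... | inj₁ (refl , refl) = l~r
    ... | inj₂ (_ , e′)      = adjacent e′
    domain′ : ∀ {x s} → (f [ l ]≔ just r) x ≡ just s → P x ≡ true
    domain′ e with ≔-just f l (just r) e
    ... | inj₁ (refl , refl) = Pl
    ... | inj₂ (_ , e′)      = domain e′
    injective′ : ∀ {x x′ s} → (f [ l ]≔ just r) x ≡ just s → (f [ l ]≔ just r) x′ ≡ just s → x ≡ x′
    injective′ e e′ with ≔-just f l (just r) e | ≔-just f l (just r) e′
    ... | inj₁ (refl , _)    | inj₁ (refl , _)     = refl
    ... | inj₁ (refl , refl) | inj₂ (_ , e″)       = ⊥-elim (free _ e″)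
    ... | inj₂ (_ , e″)      | inj₁ (refl , refl)  = ⊥-elim (free _ e″)
    ... | inj₂ (_ , e″)      | inj₂ (_ , e‴)       = injective e″ e‴

  module _ {D} (0<D : 0 < D) (degree≤D : ∀ v → degree (adj G) v ≤ D)
           (degree-P : ∀ {v} → P v ≡ true → degree (adj G) v ≡ D) where

    -- Double count the pairs (l , r) with l ∈ X and l ~ r: there are D·|X| of them, each r lies
    -- in f(X ∩ dom f), and each r occurs in at most deg r ≤ D of them.
    neighbourhood-covered⇒assigned : ∀ (f : PartialMap n) (X : Fin n → Bool) → X ⊆ᵇ P →
      (∀ {l r} → X l ≡ true → adj G l r ≡ true → ∃[ l′ ] X l′ ≡ true × f l′ ≡ just r) →
      ∀ {l₀} → X l₀ ≡ true → f l₀ ≡ nothing → ⊥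
    neighbourhood-covered⇒assigned f X X⊆P covered {l₀} Xl₀ fl₀ =
      <⇒≱ assigned<X (*-cancelˡ-≤ D {{ℕ.>-nonZero 0<D}} (begin
        D * count X                                    ≡⟨ *-distribˡ-sum D (𝟙 ∘ X) ⟩
        ∑ (λ l → D * 𝟙 (X l))                          ≡⟨ ∑-cong edges-from ⟨
        ∑ (λ l → ∑ (λ r → 𝟙 (X l ∧ adj G l r)))        ≡⟨ ∑-comm (λ l r → 𝟙 (X l ∧ adj G l r)) ⟩
        ∑ (λ r → ∑ (λ l → 𝟙 (X l ∧ adj G l r)))        ≤⟨ ∑-mono-≤ edges-into ⟩
        ∑ (λ r → D * ∑ (λ l → 𝟙 (X l ∧ (f l ↦? r))))  ≡⟨ *-distribˡ-sum D (λ r → ∑ (λ l → 𝟙 (X l ∧ (f l ↦? r)))) ⟨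
        D * ∑ (λ r → ∑ (λ l → 𝟙 (X l ∧ (f l ↦? r))))  ≡⟨ cong (D *_) (∑-comm (λ l r → 𝟙 (X l ∧ (f l ↦? r)))) ⟨
        D * ∑ (λ l → ∑ (λ r → 𝟙 (X l ∧ (f l ↦? r))))  ≡⟨ cong (D *_) (∑-cong images) ⟩
        D * count (λ l → X l ∧ is-just (f l))          ∎))
      where
      open ≤-Reasoning
      assigned<X : count (λ l → X l ∧ is-just (f l)) < count X
      assigned<X = count-< (λ l → ∧-conicalˡ (X l) _) l₀ (cong₂ _∧_ Xl₀ (cong is-just fl₀)) Xl₀
      edges-from : ∀ l → ∑ (λ r → 𝟙 (X l ∧ adj G l r)) ≡ D * 𝟙 (X l)
      edges-from l with X l in Xl
      ... | true  = trans (sym (degree≡count (adj G) l)) (trans (degree-P (X⊆P l Xl)) (sym (*-identityʳ D)))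
      ... | false = trans (∑-zero n) (sym (*-zeroʳ D))
      images : ∀ l → ∑ (λ r → 𝟙 (X l ∧ (f l ↦? r))) ≡ 𝟙 (X l ∧ is-just (f l))
      images l with X l
      ... | true  = count-↦? (f l)
      ... | false = ∑-zero n
      edges-into : ∀ r → ∑ (λ l → 𝟙 (X l ∧ adj G l r)) ≤ D * ∑ (λ l → 𝟙 (X l ∧ (f l ↦? r)))
      edges-into r with ∑ (λ l → 𝟙 (X l ∧ adj G l r)) in eq
      ... | zero  = z≤n
      ... | suc k with ∑-positive (λ l → 𝟙 (X l ∧ adj G l r)) (subst (0 <_) (sym eq) (s≤s z≤n))
      ... | l , 0<𝟙 with 𝟙-positive 0<𝟙
      ... | X∧adj with covered (∧-conicalˡ (X l) _ X∧adj) (∧-conicalʳ (X l) _ X∧adj)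
      ... | l′ , Xl′ , fl′ = begin
        suc k                                     ≡⟨ eq ⟨
        ∑ (λ l → 𝟙 (X l ∧ adj G l r))             ≤⟨ ∑-mono-≤ (λ l → 𝟙-mono (trans (Graph.sym G r l) ∘ ∧-conicalʳ (X l) _)) ⟩
        count (adj G r)                           ≡⟨ degree≡count (adj G) r ⟨
        degree (adj G) r                          ≤⟨ degree≤D r ⟩
        D                                         ≡⟨ *-identityʳ D ⟨
        D * 1                                     ≤⟨ *-monoʳ-≤ D (begin
          1                                         ≡⟨ cong 𝟙 (cong₂ _∧_ Xl′ (↦?-complete fl′)) ⟨
          𝟙 (X l′ ∧ (f l′ ↦? r))                    ≤⟨ ∑-≥-term (λ l → 𝟙 (X l ∧ (f l ↦? r))) l′ ⟩
          ∑ (λ l → 𝟙 (X l ∧ (f l ↦? r)))            ∎) ⟩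
        D * ∑ (λ l → 𝟙 (X l ∧ (f l ↦? r)))        ∎

    module Augmentation (m : PartialMap n) (M : DistinctNeighbours m)
                        {l₀ : Fin n} (Pl₀ : P l₀ ≡ true) (ml₀ : m l₀ ≡ nothing) where

      Augmented : Set
      Augmented = ∃[ m′ ] DistinctNeighbours m′ × m ⊑ m′ × is-just (m′ l₀) ≡ true

      record Reroute (X : Fin n → Bool) (l : Fin n) : Set where
        field
          rerouting : PartialMap n
          valid     : DistinctNeighbours rerouting
          keeps     : ∀ {x} → ¬ x ≡ l → is-just (m x) ≡ true ⊎ x ≡ l₀ → is-just (rerouting x) ≡ true
          outside   : ∀ {x} → X x ≡ false → rerouting x ≡ m x
          values    : ∀ {x r} → rerouting x ≡ just r → ∃[ y ] m y ≡ just r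

      -- X is grown from l₀ along m-alternating paths l ~ r = m l′; shifting m along the path to l
      -- frees l while keeping the rest of dom m ∪ {l₀} assigned (a Reroute).
      record AlternatingTree : Set where
        field
          X       : Fin n → Bool
          root    : X l₀ ≡ true
          X⊆P     : X ⊆ᵇ P
          reroute : ∀ {l} → X l ≡ true → Reroute X l

      open AlternatingTree

      finish : ∀ T {l r} → X T l ≡ true → adj G l r ≡ true → (∀ y → ¬ m y ≡ just r) → Augmented
      finish T {l} {r} Xl l~r free =
        rerouting [ l ]≔ just r , assign valid (X⊆P T l Xl) l~r free′ , extends , covers (inj₂ refl)
        where
        open Reroute (reroute T Xl)
        free′ : ∀ x → ¬ rerouting x ≡ just r
        free′ x e = let y , my = values e in free y my
        covers : ∀ {x} → is-just (m x) ≡ true ⊎ x ≡ l₀ → is-just ((rerouting [ l ]≔ just r) x) ≡ true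
        covers {x} target with ≔-cases rerouting l (just r) x
        ... | inj₁ (_ , e)   = cong is-just e
        ... | inj₂ (x≢l , e) = trans (cong is-just e) (keeps x≢l target)
        extends : m ⊑ (rerouting [ l ]≔ just r)
        extends x mx = covers (inj₁ mx)

      extend : ∀ T {l r l′} → X T l ≡ true → adj G l r ≡ true → m l′ ≡ just r → X T l′ ≡ false → AlternatingTree
      extend T {l} {r} {l′} Xl l~r ml′ Xl′ = record
        { X = X′ ; root = grows (root T) ; X⊆P = X′⊆P ; reroute = reroute′ }
        where
        X′ : Fin n → Bool
        X′ = X T [ l′ ]≔ true
        grows : ∀ {x} → X T x ≡ true → X′ x ≡ true
        grows {x} = ≔-mono id (X T) l′ refl x
        shrinks : ∀ {x} → X′ x ≡ false → X T x ≡ false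
        shrinks {x} X′x with ≔-cases (X T) l′ true x
        ... | inj₁ (_ , e) = ⊥-elim (true≢false (trans (sym e) X′x))
        ... | inj₂ (_ , e) = trans (sym e) X′x
        X′⊆P : X′ ⊆ᵇ P
        X′⊆P x X′x with ≔-cases (X T) l′ true x
        ... | inj₁ (refl , _) = DistinctNeighbours.domain M ml′
        ... | inj₂ (_ , e)    = X⊆P T x (trans (sym e) X′x)
        widen : ∀ {x} → Reroute (X T) x → Reroute X′ x
        widen R = record { Reroute R ; outside = Reroute.outside R ∘ shrinks }
        rerouted : Reroute X′ l′
        rerouted = record
          { rerouting = rerouting′ ; valid = valid′ ; keeps = keeps′ ; outside = outside′ ; values = values′ }
          where
          open Reroute (reroute T Xl)
          rerouting-l′ : rerouting l′ ≡ just r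
          rerouting-l′ = trans (outside Xl′) ml′
          rerouting′ : PartialMap n
          rerouting′ = (rerouting [ l′ ]≔ nothing) [ l ]≔ just r
          valid′ : DistinctNeighbours rerouting′
          valid′ = assign (unassign valid l′) (X⊆P T l Xl) l~r free
            where
            free : ∀ x → ¬ (rerouting [ l′ ]≔ nothing) x ≡ just r
            free x e with ≔-just rerouting l′ nothing e
            ... | inj₂ (x≢l′ , mx) = x≢l′ (DistinctNeighbours.injective valid mx rerouting-l′)
          rerouting′-others : ∀ {x} → ¬ x ≡ l → ¬ x ≡ l′ → rerouting′ x ≡ rerouting x
          rerouting′-others x≢l x≢l′ = trans (≔-there _ l (just r) x≢l) (≔-there rerouting l′ nothing x≢l′)
          keeps′ : ∀ {x} → ¬ x ≡ l′ → is-just (m x) ≡ true ⊎ x ≡ l₀ → is-just (rerouting′ x) ≡ true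
          keeps′ {x} x≢l′ target with x ≟ l
          ... | yes refl = cong is-just (≔-here _ l (just r))
          ... | no x≢l   = trans (cong is-just (rerouting′-others x≢l x≢l′)) (keeps x≢l target)
          outside′ : ∀ {x} → X′ x ≡ false → rerouting′ x ≡ m x
          outside′ {x} X′x = trans (rerouting′-others x≢l x≢l′) (outside (shrinks X′x))
            where
            x≢l : ¬ x ≡ l
            x≢l refl = true≢false (trans (sym Xl) (shrinks X′x))
            x≢l′ : ¬ x ≡ l′
            x≢l′ refl = true≢false (trans (sym (≔-here (X T) l′ true)) X′x)
          values′ : ∀ {x s} → rerouting′ x ≡ just s → ∃[ y ] m y ≡ just s
          values′ e with ≔-just _ l (just r) e
          ... | inj₁ (_ , refl) = l′ , ml′
          ... | inj₂ (_ , e′) with ≔-just rerouting l′ nothing e′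
          ... | inj₂ (_ , e″) = values e″
        reroute′ : ∀ {x} → X′ x ≡ true → Reroute X′ x
        reroute′ {x} X′x with ≔-cases (X T) l′ true x
        ... | inj₁ (refl , _) = rerouted
        ... | inj₂ (_ , e)    = widen (reroute T (trans (sym e) X′x))

      InImage : (Fin n → Bool) → Fin n → Set
      InImage X r = ∃[ y ] X y ≡ true × m y ≡ just r

      in-image? : ∀ X r → Dec (InImage X r)
      in-image? X r = any? (λ y → (X y Bool.≟ true) ×-dec Maybe.≡-dec _≟_ (m y) (just r))

      outside-count : AlternatingTree → ℕ
      outside-count T = count (not ∘ X T)

      grow : ∀ T → Augmented ⊎ Σ AlternatingTree (λ T′ → outside-count T′ < outside-count T)
      grow T with any? (λ l → any? (λ r →
        (X T l Bool.≟ true) ×-dec (adj G l r Bool.≟ true) ×-dec ¬? (in-image? (X T) r)))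
      ... | no closed = ⊥-elim (neighbourhood-covered⇒assigned m (X T) (X⊆P T) covered (root T) ml₀)
        where
        covered : ∀ {l r} → X T l ≡ true → adj G l r ≡ true → InImage (X T) r
        covered Xl l~r = decidable-stable (in-image? (X T) _) (λ r∉ → closed (_ , _ , Xl , l~r , r∉))
      ... | yes (l , r , Xl , l~r , r∉) with any? (λ y → Maybe.≡-dec _≟_ (m y) (just r))
      ... | no free = inj₁ (finish T Xl l~r (λ y e → free (y , e)))
      ... | yes (l′ , ml′) with X T l′ in Xl′
      ... | true  = ⊥-elim (r∉ (l′ , Xl′ , ml′))
      ... | false = inj₂ (extend T Xl l~r ml′ Xl′ ,
        count-< (not-⊆ᵇ (≔-mono id (X T) l′ refl)) l′ (cong not (≔-here (X T) l′ true)) (cong not Xl′))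

      seed : AlternatingTree
      seed = record
        { X = X₀ ; root = ≔-here _ l₀ true ; X⊆P = λ x → X⊆P′ ∘ only-root ; reroute = reroute′ ∘ only-root }
        where
        X₀ : Fin n → Bool
        X₀ = const false [ l₀ ]≔ true
        only-root : ∀ {x} → X₀ x ≡ true → x ≡ l₀
        only-root {x} X₀x with ≔-cases (const false) l₀ true x
        ... | inj₁ (x≡l₀ , _) = x≡l₀
        ... | inj₂ (_ , e)    = ⊥-elim (true≢false (trans (sym X₀x) e))
        X⊆P′ : ∀ {x} → x ≡ l₀ → P x ≡ true
        X⊆P′ refl = Pl₀
        reroute′ : ∀ {x} → x ≡ l₀ → Reroute X₀ x
        reroute′ refl = record
          { rerouting = m ; valid = M ; outside = λ _ → refl ; values = λ e → _ , e
          ; keeps = λ { _ (inj₁ mx) → mx ; x≢l₀ (inj₂ refl) → ⊥-elim (x≢l₀ refl) } }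

      augment : Augmented
      augment = descend outside-count grow seed

    distinct-neighbours : ∃[ f ] DistinctNeighbours f × (∀ {l} → P l ≡ true → ∃[ r ] f l ≡ just r)
    distinct-neighbours =
      descend unassigned grow (const nothing , record { adjacent = λ () ; domain = λ () ; injective = λ () })
      where
      unassigned : Σ (PartialMap n) DistinctNeighbours → ℕ
      unassigned (f , _) = count (λ l → P l ∧ not (is-just (f l)))
      grow : ∀ fF → (∃[ f ] DistinctNeighbours f × (∀ {l} → P l ≡ true → ∃[ r ] f l ≡ just r)) ⊎
                    Σ (Σ (PartialMap n) DistinctNeighbours) (λ gG → unassigned gG < unassigned fF)
      grow (f , F) with any? (λ l → (P l Bool.≟ true) ×-dec Maybe.≡-dec _≟_ (f l) nothing)
      ... | no none = inj₁ (f , F , total)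
        where
        total : ∀ {l} → P l ≡ true → ∃[ r ] f l ≡ just r
        total {l} Pl with f l in fl
        ... | just r  = r , refl
        ... | nothing = ⊥-elim (none (l , Pl , fl))
      ... | yes (l₀ , Pl₀ , fl₀) with Augmentation.augment f F Pl₀ fl₀
      ... | f′ , F′ , f⊑f′ , f′l₀ =
        inj₂ ((f′ , F′) , count-< shrinks l₀ (cong₂ _∧_ Pl₀ (cong not f′l₀)) (cong₂ _∧_ Pl₀ (cong (not ∘ is-just) fl₀)))
        where
        shrinks : (λ l → P l ∧ not (is-just (f′ l))) ⊆ᵇ (λ l → P l ∧ not (is-just (f l)))
        shrinks l e = cong₂ _∧_ (∧-conicalˡ (P l) _ e) (not-⊆ᵇ f⊑f′ l (∧-conicalʳ (P l) _ e))

-- Mitigating subgraphs whose components are paths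

module PathCover {n} {G : Graph n} {p : PartialMap n} (Mt : Matching G p) (Mx : Maximal G p) {f : PartialMap n}
                 (F : DistinctNeighbours G (λ v → is-max-degree G v ∧ not (is-just (p v))) f)
                 (total : ∀ {v} → is-max-degree G v ∧ not (is-just (p v)) ≡ true → ∃[ r ] f v ≡ just r) where

  open Matching Mt
  open DistinctNeighbours F renaming (adjacent to f-adjacent)

  f-source-unmatched : ∀ {w z} → f w ≡ just z → p w ≡ nothing
  f-source-unmatched {w} e with p w | ∧-conicalʳ (is-max-degree G w) _ (domain e)
  ... | nothing | _ = refl

  f-target-matched : ∀ {w z} → f w ≡ just z → ∃[ y ] p z ≡ just y
  f-target-matched e = Mx (f-source-unmatched e) (f-adjacent e)

  image : Fin n → Bool
  image x = does (any? (λ z → Maybe.≡-dec _≟_ (f z) (just x)))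

  image-intro : ∀ {z x} → f z ≡ just x → image x ≡ true
  image-intro {z} e = dec-true (any? _) (z , e)

  image-elim : ∀ {x} → image x ≡ true → ∃[ z ] f z ≡ just x
  image-elim = does⇒ (any? _)

  data Edge (x y : Fin n) : Set where
    matched  : p x ≡ just y → image x ∧ image y ≡ false → Edge x y
    forward  : f x ≡ just y → Edge x y
    backward : f y ≡ just x → Edge x y

  -- Dropping the matching edge between two f-targets splits a path r x x′ r′ into r x and x′ r′.
  kept : Adj n
  kept x y = (p x ↦? y) ∧ not (image x ∧ image y)

  edge? : Adj n
  edge? x y = kept x y ∨ (f x ↦? y) ∨ (f y ↦? x)

  edge?-sound : ∀ {x y} → edge? x y ≡ true → Edge x y
  edge?-sound {x} {y} e with kept x y in kxy | (f x ↦? y) in fwd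
  ... | true  | _    = matched (↦?-sound (p x) (∧-conicalˡ _ _ kxy)) (not-true (∧-conicalʳ (p x ↦? y) _ kxy))
  ... | false | true = forward (↦?-sound (f x) fwd)
  ... | false | false = backward (↦?-sound (f y) e)

  edge?-complete : ∀ {x y} → Edge x y → edge? x y ≡ true
  edge?-complete {x} {y} (matched pxy images) =
    cong (_∨ _) (cong₂ _∧_ (↦?-complete pxy) (cong not images))
  edge?-complete {x} {y} (forward fxy) =
    trans (cong (λ b → kept x y ∨ (b ∨ (f y ↦? x))) (↦?-complete fxy)) (∨-zeroʳ (kept x y))
  edge?-complete {x} {y} (backward fyx) =
    trans (cong (λ c → kept x y ∨ ((f x ↦? y) ∨ c)) (↦?-complete fyx))
          (trans (cong (kept x y ∨_) (∨-zeroʳ (f x ↦? y))) (∨-zeroʳ (kept x y)))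

  edge-sym : ∀ {x y} → Edge x y → Edge y x
  edge-sym {x} {y} (matched pxy images) = matched (symmetric pxy) (trans (∧-comm (image y) (image x)) images)
  edge-sym (forward fxy)  = backward fxy
  edge-sym (backward fyx) = forward fyx

  edge⊆G : ∀ {x y} → Edge x y → adj G x y ≡ true
  edge⊆G (matched pxy _)        = adjacent pxy
  edge⊆G (forward fxy)          = f-adjacent fxy
  edge⊆G {x} {y} (backward fyx) = trans (Graph.sym G x y) (f-adjacent fyx)

  S : EdgeSet G
  S = edge-set G edge? (edge?-complete ∘ edge-sym ∘ edge?-sound) (edge⊆G ∘ edge?-sound)

  covers : ∀ v → degree (adj G) v ≡ Δ (adj G) → ∃[ u ] eadj S v u ≡ true
  covers v deg with just-or-nothing (p v)
  ... | inj₂ pv with total (cong₂ _∧_ (dec-true (_ ℕ.≟ _) deg) (cong (not ∘ is-just) pv))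
  ...   | x , fv = x , edge?-complete (forward fv)
  covers v deg | inj₁ (y , pv) with image v ∧ image y in images
  ...   | false = y , edge?-complete (matched pv images)
  ...   | true  = let z , fz = image-elim (∧-conicalˡ _ _ images) in z , edge?-complete (backward fz)

  f-source-neighbour : ∀ {w x z} → f w ≡ just x → Edge w z → z ≡ x
  f-source-neighbour fw (matched pw _) = ⊥-elim (nothing≢just (trans (sym (f-source-unmatched fw)) pw))
  f-source-neighbour fw (forward fw′)  = Maybe.just-injective (trans (sym fw′) fw)
  f-source-neighbour fw (backward fz)  =
    let _ , pw = f-target-matched fz in ⊥-elim (nothing≢just (trans (sym (f-source-unmatched fw)) pw))

  matched-neighbour : ∀ {w w′ z} → p w ≡ just w′ → Edge w z → (z ≡ w′ × image w ∧ image w′ ≡ false) ⊎ f z ≡ just w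
  matched-neighbour pw′ (matched pw images) with trans (sym pw′) pw
  ... | refl = inj₁ (refl , images)
  matched-neighbour pw′ (forward fw)  = ⊥-elim (nothing≢just (trans (sym (f-source-unmatched fw)) pw′))
  matched-neighbour pw′ (backward fz) = inj₂ fz

  short-path : ∀ {r x y} → f r ≡ just x → p x ≡ just y → image y ≡ true →
               ∀ {v} → v ≡ r ⊎ v ≡ x → ComponentP₂ S v
  short-path {r} {x} {y} fr px imy = component-P₂ S (edge?-complete (forward fr)) closed
    where
    closed : ∀ {w z} → w ≡ r ⊎ w ≡ x → eadj S w z ≡ true → z ≡ r ⊎ z ≡ x
    closed (inj₁ refl) e = inj₂ (f-source-neighbour fr (edge?-sound e))
    closed (inj₂ refl) e with matched-neighbour px (edge?-sound e)
    ... | inj₁ (_ , images) = ⊥-elim (true≢false (trans (sym (cong₂ _∧_ (image-intro fr) imy)) images))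
    ... | inj₂ fz           = inj₁ (injective fz fr)

  long-path : ∀ {r x y} → f r ≡ just x → p x ≡ just y → image y ≡ false →
              ∀ {v} → v ≡ r ⊎ v ≡ x ⊎ v ≡ y → ComponentP₃ S v
  long-path {r} {x} {y} fr px imy =
    component-P₃ S (edge?-complete (forward fr)) (edge?-complete (matched px images)) r≁y r≢y closed
    where
    py : p y ≡ just x
    py = symmetric px
    images : image x ∧ image y ≡ false
    images = trans (cong (image x ∧_) imy) (∧-zeroʳ (image x))
    r≁y : edge? r y ≡ false
    r≁y = ¬-not λ e → adj⇒≢ G (adjacent px) (sym (f-source-neighbour fr (edge?-sound e)))
    r≢y : ¬ r ≡ y
    r≢y refl = nothing≢just (trans (sym (f-source-unmatched fr)) py)
    closed : ∀ {w z} → w ≡ r ⊎ w ≡ x ⊎ w ≡ y → eadj S w z ≡ true → z ≡ r ⊎ z ≡ x ⊎ z ≡ y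
    closed (inj₁ refl) e = inj₂ (inj₁ (f-source-neighbour fr (edge?-sound e)))
    closed (inj₂ (inj₁ refl)) e with matched-neighbour px (edge?-sound e)
    ... | inj₁ (refl , _) = inj₂ (inj₂ refl)
    ... | inj₂ fz         = inj₁ (injective fz fr)
    closed (inj₂ (inj₂ refl)) e with matched-neighbour py (edge?-sound e)
    ... | inj₁ (refl , _) = inj₂ (inj₁ refl)
    ... | inj₂ fz         = ⊥-elim (true≢false (trans (sym (image-intro fz)) imy))

  matching-edge : ∀ {x y} → p x ≡ just y → image x ≡ false → image y ≡ false →
                  ∀ {v} → v ≡ x ⊎ v ≡ y → ComponentP₂ S v
  matching-edge {x} {y} px imx imy = component-P₂ S (edge?-complete (matched px (cong (_∧ image y) imx))) closed
    where
    closed : ∀ {w z} → w ≡ x ⊎ w ≡ y → eadj S w z ≡ true → z ≡ x ⊎ z ≡ y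
    closed (inj₁ refl) e with matched-neighbour px (edge?-sound e)
    ... | inj₁ (refl , _) = inj₂ refl
    ... | inj₂ fz         = ⊥-elim (true≢false (trans (sym (image-intro fz)) imx))
    closed (inj₂ refl) e with matched-neighbour (symmetric px) (edge?-sound e)
    ... | inj₁ (refl , _) = inj₁ refl
    ... | inj₂ fz         = ⊥-elim (true≢false (trans (sym (image-intro fz)) imy))

  components : ComponentsP₂P₃ S
  components v (u , v~u) with just-or-nothing (f v) | just-or-nothing (p v)
  ... | inj₁ (x , fv) | _ with f-target-matched fv
  ...   | y , px with image y in imy
  ...     | true  = inj₁ (short-path fv px imy (inj₁ refl))
  ...     | false = inj₂ (long-path fv px imy (inj₁ refl))
  components v (u , v~u) | inj₂ fv | inj₁ (y , pv) with image v in imv | image y in imy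
  ... | true  | true  = let r , fr = image-elim imv in inj₁ (short-path fr pv imy (inj₂ refl))
  ... | true  | false = let r , fr = image-elim imv in inj₂ (long-path fr pv imy (inj₂ (inj₁ refl)))
  ... | false | true  = let r , fr = image-elim imy in inj₂ (long-path fr (symmetric pv) imv (inj₂ (inj₂ refl)))
  ... | false | false = inj₁ (matching-edge pv imv imy (inj₁ refl))
  components v (u , v~u) | inj₂ fv | inj₂ pv with edge?-sound v~u
  ... | matched pv′ _ = ⊥-elim (nothing≢just (trans (sym pv) pv′))
  ... | forward fv′   = ⊥-elim (nothing≢just (trans (sym fv) fv′))
  ... | backward fu   = let _ , pv′ = f-target-matched fu in ⊥-elim (nothing≢just (trans (sym pv) pv′))

mitigating-path-cover : ∀ {n} (G : Graph n) → HasEdge G → Σ (EdgeSet G) λ S → Mitigating G S × ComponentsP₂P₃ S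
mitigating-path-cover G has-edge with maximal-matching G
... | p , Mt , Mx with distinct-neighbours G (λ v → is-max-degree G v ∧ not (is-just (p v)))
                         (Δ-positive G has-edge) (degree≤Δ (adj G)) (is-max-degree-sound G ∘ ∧-conicalˡ _ _)
... | f , F , total = S , covering⇒mitigating G S covers , components
  where open PathCover Mt Mx F total

-- Mitigating sets with at most n − |I| edges

module IndependentComplement {n} {G : Graph n} (0<Δ : 0 < Δ (adj G))
                              {I : VSet n} (independent : Independent G I) {f : PartialMap n}
                              (F : DistinctNeighbours G (λ v → is-max-degree G v ∧ I v) f)
                              (total : ∀ {v} → is-max-degree G v ∧ I v ≡ true → ∃[ r ] f v ≡ just r) where

  open DistinctNeighbours F

  preimage? : ∀ c → Dec (∃[ z ] f z ≡ just c)
  preimage? c = any? (λ z → Maybe.≡-dec _≟_ (f z) (just c))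

  neighbour? : ∀ c → Dec (∃[ u ] adj G c u ≡ true)
  neighbour? c = any? (λ u → adj G c u Bool.≟ true)

  -- S consists of the edges c (h c), so |S| ≤ |dom h| ≤ n − |I|.  Preferring the preimage
  -- makes every vertex of I of degree Δ an endpoint.
  h : PartialMap n
  h c = if I c then nothing else (choice (preimage? c) <∣> choice (neighbour? c))

  h-sound : ∀ {c u} → h c ≡ just u → I c ≡ false × adj G c u ≡ true
  h-sound {c} e with I c | choice (preimage? c) in pre
  ... | false | just z   with e
  ...   | refl = refl , trans (Graph.sym G c z) (adjacent (choice-sound (preimage? c) pre))
  h-sound {c} e | false | nothing = refl , choice-sound (neighbour? c) e

  h-preimage : ∀ {c z} → I c ≡ false → f z ≡ just c → h c ≡ just z
  h-preimage {c} {z} Ic fz rewrite Ic =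
    let z′ , pre = choice-complete (preimage? c) fz
    in trans (cong (_<∣> _) pre) (cong just (injective (choice-sound (preimage? c) pre) fz))

  h-defined : ∀ {c u} → I c ≡ false → adj G c u ≡ true → ∃[ w ] h c ≡ just w
  h-defined {c} Ic c~u rewrite Ic with choice (preimage? c)
  ... | just z  = z , refl
  ... | nothing = choice-complete (neighbour? c) c~u

  edge? : Adj n
  edge? x y = (h x ↦? y) ∨ (h y ↦? x)

  edge?-sound : ∀ {x y} → edge? x y ≡ true → h x ≡ just y ⊎ h y ≡ just x
  edge?-sound {x} {y} e with h x ↦? y in hxy
  ... | true  = inj₁ (↦?-sound (h x) hxy)
  ... | false = inj₂ (↦?-sound (h y) e)

  edge?-complete : ∀ {x y} → h x ≡ just y ⊎ h y ≡ just x → edge? x y ≡ true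
  edge?-complete {x} {y} (inj₁ hxy) = cong (_∨ (h y ↦? x)) (↦?-complete hxy)
  edge?-complete {x} {y} (inj₂ hyx) = trans (cong ((h x ↦? y) ∨_) (↦?-complete hyx)) (∨-zeroʳ (h x ↦? y))

  S : EdgeSet G
  S = edge-set G edge? (edge?-complete ∘ swap ∘ edge?-sound) (along-G ∘ edge?-sound)
    where
    along-G : ∀ {x y} → h x ≡ just y ⊎ h y ≡ just x → adj G x y ≡ true
    along-G (inj₁ hxy)         = proj₂ (h-sound hxy)
    along-G {x} {y} (inj₂ hyx) = trans (Graph.sym G x y) (proj₂ (h-sound hyx))

  covers : ∀ v → degree (adj G) v ≡ Δ (adj G) → ∃[ u ] eadj S v u ≡ true
  covers v deg with I v Bool.≟ true
  ... | yes Iv with total (cong₂ _∧_ (dec-true (_ ℕ.≟ _) deg) Iv)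
  ...   | c , fv = c , edge?-complete (inj₂ (h-preimage Ic fv))
    where
    Ic : I c ≡ false
    Ic = ¬-not λ c∈I → true≢false (trans (sym (adjacent fv)) (independent v c Iv c∈I))
  covers v deg | no ¬Iv with positive-degree⇒neighbour (adj G) (subst (0 <_) (sym deg) 0<Δ)
  ...   | u , v~u with h-defined (¬-not ¬Iv) v~u
  ...     | w , hv = w , edge?-complete (inj₁ hv)

  size : ∣ S ∣ₑ ≤ n ∸ ∣ I ∣ᵥ
  size = begin
    ∣ S ∣ₑ               ≤⟨ size≤defined S h edge?-sound ⟩
    count (is-just ∘ h)  ≤⟨ count-mono h⊆C ⟩
    count (not ∘ I)      ≡⟨ count-not I ⟩
    n ∸ count I          ≡⟨ cong (n ∸_) (countL-allFin I) ⟨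
    n ∸ ∣ I ∣ᵥ           ∎
    where
    open ≤-Reasoning
    h⊆C : (is-just ∘ h) ⊆ᵇ (not ∘ I)
    h⊆C c defined with just-or-nothing (h c)
    ... | inj₁ (_ , hc) = cong not (proj₁ (h-sound hc))
    ... | inj₂ hc       = ⊥-elim (true≢false (trans (sym defined) (cong is-just hc)))

mitigating-set≤n∸∣I∣ : ∀ {n} (G : Graph n) → HasEdge G → ∀ {I} → Independent G I →
                       Σ (EdgeSet G) λ S → Mitigating G S × ∣ S ∣ₑ ≤ n ∸ ∣ I ∣ᵥ
mitigating-set≤n∸∣I∣ G has-edge {I} independent
  with distinct-neighbours G (λ v → is-max-degree G v ∧ I v)
         (Δ-positive G has-edge) (degree≤Δ (adj G)) (is-max-degree-sound G ∘ ∧-conicalˡ _ _)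
... | f , F , total = S , covering⇒mitigating G S covers , size
  where open IndependentComplement (Δ-positive G has-edge) independent F total

esΔ≤n∸α : ∀ {n} (G : Graph n) → HasEdge G → ∀ a e → IsIndependenceNumber G a → IsEsΔ G e → e ≤ n ∸ a
esΔ≤n∸α G has-edge _ e ((I , independent , refl) , _) (_ , minimal) =
  let S , mitigating , size = mitigating-set≤n∸∣I∣ G has-edge independent
  in ≤-trans (minimal S mitigating) size

-- Sharpness

K₂ : Graph 2
K₂ = record { adj = edge ; sym = symmetric ; irrefl = λ { fzero → refl ; (fsuc fzero) → refl } }
  where
  edge : Adj 2
  edge fzero        (fsuc fzero) = true
  edge (fsuc fzero) fzero        = true
  edge _            _            = false
  symmetric : ∀ i j → edge i j ≡ edge j i
  symmetric fzero        fzero        = refl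
  symmetric fzero        (fsuc fzero) = refl
  symmetric (fsuc fzero) fzero        = refl
  symmetric (fsuc fzero) (fsuc fzero) = refl

α[K₂]≡1 : IsIndependenceNumber K₂ 1
α[K₂]≡1 = (one , independent , refl) , at-most-one
  where
  one : VSet 2
  one fzero        = true
  one (fsuc fzero) = false
  independent : Independent K₂ one
  independent fzero fzero _ _ = refl
  independent fzero (fsuc fzero) _ ()
  independent (fsuc fzero) _ () _
  at-most-one : ∀ I → Independent K₂ I → ∣ I ∣ᵥ ≤ 1
  at-most-one I independent with I fzero in I₀ | I (fsuc fzero) in I₁
  ... | true  | true  = ⊥-elim (true≢false (independent fzero (fsuc fzero) I₀ I₁))
  ... | true  | false = ≤-refl
  ... | false | true  = ≤-refl
  ... | false | false = z≤n

esΔ[K₂]≡1 : IsEsΔ K₂ 1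
esΔ[K₂]≡1 = (all-edges , z≤n , refl) , nonempty
  where
  all-edges : EdgeSet K₂
  all-edges = edge-set K₂ (adj K₂) (λ {x} {y} e → trans (Graph.sym K₂ y x) e) id
  nonempty : ∀ S → Mitigating K₂ S → 1 ≤ ∣ S ∣ₑ
  nonempty S mitigating with eadj S fzero (fsuc fzero) | ≤-trans (degree≤Δ (K₂ ⊖ S) fzero) mitigating
  ... | true  | _ = ≤-refl
  ... | false | ()

theorem2p1 : (∀ (n : ℕ) (G : Graph n) → HasEdge G →
                 (Σ (EdgeSet G) λ S → Mitigating G S × ComponentsP₂P₃ S)
                 × (∀ a e → IsIndependenceNumber G a → IsEsΔ G e → e ≤ n ∸ a))
             × (∃[ n ] Σ (Graph n) λ G → HasEdge G × ∃[ a ] ∃[ e ]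
                 (IsIndependenceNumber G a × IsEsΔ G e × e ≡ n ∸ a))
theorem2p1 = (λ n G has-edge → mitigating-path-cover G has-edge , esΔ≤n∸α G has-edge)
           , (2 , K₂ , (fzero , fsuc fzero , refl) , 1 , 1 , α[K₂]≡1 , esΔ[K₂]≡1 , refl)
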